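{- Let $\mathbf i=(i_1,\dots,i_{\bar n})\in\mathscr R(w_0^{(n+1)})$, where $\bar n=n(n+1)/2$. Then there are unique integers $d_1,\dots,d_n$ with $1\le d_1<\cdots<d_n\le\bar n$ and $(i_{d_1},\dots,i_{d_n})=(n,n-1,\dots,1)$, and there are unique integers $a_1,\dots,a_n$ with $1\le a_1<\cdots<a_n\le\bar n$ and $(i_{a_1},\dots,i_{a_n})=(1,2,\dots,n)$. Moreover $|\{a_1,\dots,a_n\}\cap\{d_1,\dots,d_n\}|=1$.
   Context: $\mathfrak S_{n+1}$ is the symmetric group on $[n+1]$ with simple transpositions $s_i=(i,i+1)$, $i\in[n]$. A word $(i_1,\dots,i_r)$ is a reduced word of $w$ if $w=s_{i_1}\cdots s_{i_r}$ and $r$ is minimal among such expressions; $\mathscr R(w)$ is the set of reduced words of $w$. $w_0^{(n+1)}$ is the longest element of $\mathfrak S_{n+1}$ (one-line notation $n+1\,n\,\cdots\,1$), whose length is $n(n+1)/2$. -}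

module Defs where

open import Data.Nat using (ℕ; zero; suc; _∸_; _*_; _≤_; _<_; _≡ᵇ_)
open import Data.Nat.DivMod using (_/_)
open import Data.Bool using (if_then_else_)
open import Data.List using (List; []; _∷_; map; upTo; length; filter)
open import Data.List.Relation.Unary.All using (All)
open import Data.List.Membership.DecPropositional Data.Nat._≟_ using (_∈?_)
open import Data.Fin using (Fin; toℕ)
open import Data.List using (allFin)
open import Data.Product using (_×_; Σ)
open import Relation.Binary.PropositionalEquality using (_≡_)
import Data.Nat

s : ℕ → ℕ → ℕ
s i j = if j ≡ᵇ i then suc i else (if j ≡ᵇ suc i then i else j)

apply : List ℕ → ℕ → ℕ
apply []       j = j
apply (i ∷ is) j = s i (apply is j)

oneLine : ℕ → List ℕ → List ℕ
oneLine n word = map (λ k → apply word (suc k)) (upTo (suc n))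

w0 : ℕ → List ℕ
w0 n = map (λ k → suc n ∸ k) (upTo (suc n))

IsWord : ℕ → List ℕ → Set
IsWord n word = All (λ i → (1 ≤ i) × (i ≤ n)) word

IsReducedWord : ℕ → List ℕ → List ℕ → Set
IsReducedWord n w word =
  IsWord n word × (oneLine n word ≡ w) ×
  (∀ word' → IsWord n word' → oneLine n word' ≡ w → length word ≤ length word')

nbar : ℕ → ℕ
nbar n = (n * suc n) / 2

-- 1-based entry i_p of a word (0 outside the range 1..length).
at : List ℕ → ℕ → ℕ
at []       _             = 0
at (x ∷ xs) zero          = 0
at (x ∷ xs) (suc zero)    = x
at (x ∷ xs) (suc (suc k)) = at xs (suc k)

-- p : Fin n → ℕ encodes p_1 < ⋯ < p_n (p_{k+1} = p k) with 1 ≤ p_1 and p_n ≤ n̄,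
-- such that i_{p_{k+1}} = target k.
IsSubseqPositions : {n : ℕ} → ℕ → List ℕ → (Fin n → ℕ) → (Fin n → ℕ) → Set
IsSubseqPositions {n} N word target p =
  (∀ k → (1 ≤ p k) × (p k ≤ N)) ×
  (∀ k l → toℕ k < toℕ l → p k < p l) ×
  (∀ k → at word (p k) ≡ target k)

-- |{a_1,…,a_n} ∩ {d_1,…,d_n}| for injective a (the a_k are strictly increasing).
interSize : {n : ℕ} → (Fin n → ℕ) → (Fin n → ℕ) → ℕ
interSize {n} a d = length (filter (_∈? map d (allFin n)) (map a (allFin n)))

-- In a reduced word of the longest element every letter is an ascent of the prefix read so far:
-- each letter changes the inversion number by at most one, that number has to grow from 0 to
-- n(n+1)/2, and a reduced word of w0 has at most n(n+1)/2 letters. Hence the value 1 only moves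
-- right, from place 1 to place n+1, one step at each letter equal to its current place, and these
-- letters are the unique occurrence of 1, 2, …, n as a subsequence. Symmetrically the value n+1
-- moves left and yields n, …, 1. A letter lies in both subsequences exactly when it swaps these two
-- values, which happens once.
module Submission where

open import Defs
open import Data.Nat using (ℕ; zero; suc; pred; _+_; _*_; _∸_; _≤_; _<_; _≡ᵇ_; z≤n; s≤s; z<s; s<s; _≟_; _<?_; >-nonZero)
open import Data.Nat.Properties
open import Data.Nat.DivMod using (_/_; m*n/n≡m)
open import Data.Nat.Tactic.RingSolver using (solve-∀)
open import Data.Bool using (true; false; if_then_else_)
open import Data.Empty using (⊥-elim)
open import Data.List using (List; []; _∷_; map; applyUpTo; tabulate; allFin; length; take; filter; _++_; [_])
import Data.List.Properties as List
open import Data.List.Membership.Propositional using (_∈_)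
open import Data.List.Membership.Propositional.Properties using (∈-map⁺; ∈-map⁻; ∈-allFin)
open import Data.List.Membership.DecPropositional _≟_ using (_∈?_)
open import Data.List.Relation.Unary.All using (All; []; _∷_)
import Data.List.Relation.Unary.All.Properties as All
open import Data.Fin using (Fin; toℕ; fromℕ<)
import Data.Fin.Properties as Fin
open import Data.Product using (Σ; _×_; _,_; proj₁; proj₂)
open import Data.Sum using (inj₁; inj₂)
open import Function using (_∘_; id)
open import Relation.Nullary using (¬_; yes; no; _×-dec_)
open import Relation.Unary using (Pred; Decidable)
open import Relation.Binary.Definitions using (tri<; tri≈; tri>)
open import Relation.Binary.PropositionalEquality hiding ([_])

data SView (i j v : ℕ) : Set where
  at-i     : j ≡ i     → v ≡ suc i → SView i j v
  at-suc-i : j ≡ suc i → v ≡ i     → SView i j v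
  off      : j ≢ i → j ≢ suc i → v ≡ j → SView i j v

s-view : ∀ i j → SView i j (s i j)
s-view i j = view
  where
  view : SView i j (if j ≡ᵇ i then suc i else if j ≡ᵇ suc i then i else j)
  view with j ≡ᵇ i | ≡ᵇ⇒≡ j i | ≡⇒≡ᵇ j i | j ≡ᵇ suc i | ≡ᵇ⇒≡ j (suc i) | ≡⇒≡ᵇ j (suc i)
  ... | true  | j≡i | _   | _     | _     | _     = at-i (j≡i _) refl
  ... | false | _   | j≢i | true  | j≡1+i | _     = at-suc-i (j≡1+i _) refl
  ... | false | _   | j≢i | false | _     | j≢1+i = off j≢i j≢1+i refl

s-at-i : ∀ i → s i i ≡ suc i
s-at-i i with s-view i i
... | at-i _ e       = e
... | at-suc-i e _   = ⊥-elim (1+n≢n (sym e))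
... | off i≢i _ _    = ⊥-elim (i≢i refl)

s-at-suc-i : ∀ i → s i (suc i) ≡ i
s-at-suc-i i with s-view i (suc i)
... | at-i e _        = ⊥-elim (1+n≢n e)
... | at-suc-i _ e    = e
... | off _ 1+i≢1+i _ = ⊥-elim (1+i≢1+i refl)

s-fixes : ∀ {i j} → j ≢ i → j ≢ suc i → s i j ≡ j
s-fixes {i} {j} j≢i j≢1+i with s-view i j
... | at-i e _     = ⊥-elim (j≢i e)
... | at-suc-i e _ = ⊥-elim (j≢1+i e)
... | off _ _ e    = e

s-involutive : ∀ i j → s i (s i j) ≡ j
s-involutive i j with s-view i j
... | at-i refl e     = trans (cong (s i) e) (s-at-suc-i i)
... | at-suc-i refl e = trans (cong (s i) e) (s-at-i i)
... | off _ _ e       = trans (cong (s i) e) e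

s-injective : ∀ i {x y} → s i x ≡ s i y → x ≡ y
s-injective i {x} {y} e = trans (sym (s-involutive i x)) (trans (cong (s i) e) (s-involutive i y))

s-suc : ∀ i j → s (suc i) (suc j) ≡ suc (s i j)
s-suc i j with s-view i j
... | at-i refl e     = trans (s-at-i (suc i)) (cong suc (sym e))
... | at-suc-i refl e = trans (s-at-suc-i (suc i)) (cong suc (sym e))
... | off j≢i j≢1+i e = trans (s-fixes (j≢i ∘ suc-injective) (j≢1+i ∘ suc-injective)) (cong suc (sym e))

s-≤ : ∀ {i j m} → i < m → j ≤ m → s i j ≤ m
s-≤ {i} {j} i<m j≤m with s-view i j
... | at-i _ e     = subst (_≤ _) (sym e) i<m
... | at-suc-i _ e = subst (_≤ _) (sym e) (<⇒≤ i<m)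
... | off _ _ e    = subst (_≤ _) (sym e) j≤m

reflect-s : ∀ {m i j} → suc i ≤ m → j ≤ m → m ∸ s i j ≡ s (m ∸ suc i) (m ∸ j)
reflect-s {m} {i} {j} i<m j≤m with s-view i j
... | at-i refl e = trans (cong (m ∸_) e)
      (sym (trans (cong (s (m ∸ suc i)) (+-∸-assoc 1 i<m)) (s-at-suc-i (m ∸ suc i))))
... | at-suc-i refl e = trans (cong (m ∸_) e)
      (trans (+-∸-assoc 1 i<m) (sym (s-at-i (m ∸ suc i))))
... | off j≢i j≢1+i e = trans (cong (m ∸_) e) (sym (s-fixes
      (j≢1+i ∘ ∸-cancelˡ-≡ j≤m i<m)
      (λ eq → j≢i (∸-cancelˡ-≡ j≤m (<⇒≤ i<m) (trans eq (sym (+-∸-assoc 1 i<m)))))))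

applyUpTo-cong : ∀ {f g : ℕ → ℕ} m → (∀ k → k < m → f k ≡ g k) → applyUpTo f m ≡ applyUpTo g m
applyUpTo-cong zero    f≗g = refl
applyUpTo-cong (suc m) f≗g = cong₂ _∷_ (f≗g 0 z<s) (applyUpTo-cong m (λ k k<m → f≗g (suc k) (s<s k<m)))

applyUpTo-cong⁻ : ∀ {f g : ℕ → ℕ} m → applyUpTo f m ≡ applyUpTo g m → ∀ k → k < m → f k ≡ g k
applyUpTo-cong⁻ (suc m) eq zero    _         = List.∷-injectiveˡ eq
applyUpTo-cong⁻ (suc m) eq (suc k) (s≤s k<m) = applyUpTo-cong⁻ m (List.∷-injectiveʳ eq) k k<m

oneLine-applyUpTo : ∀ n w → oneLine n w ≡ applyUpTo (λ k → apply w (suc k)) (suc n)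
oneLine-applyUpTo n w = List.map-upTo (λ k → apply w (suc k)) (suc n)

apply-++ : ∀ xs ys j → apply (xs ++ ys) j ≡ apply xs (apply ys j)
apply-++ []       ys j = refl
apply-++ (x ∷ xs) ys j = cong (s x) (apply-++ xs ys j)

apply-injective : ∀ w {x y} → apply w x ≡ apply w y → x ≡ y
apply-injective []      e = e
apply-injective (i ∷ w) e = apply-injective w (s-injective i e)

apply-zero : ∀ {n} w → IsWord n w → apply w 0 ≡ 0
apply-zero []      []                  = refl
apply-zero (zero ∷ w)  ((() , _) ∷ _)
apply-zero (suc i ∷ w) (_ ∷ isw) = cong (s (suc i)) (apply-zero w isw)

apply-≤ : ∀ {n} w → IsWord n w → ∀ {x} → x ≤ suc n → apply w x ≤ suc n
apply-≤ []      []                 x≤1+n = x≤1+n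
apply-≤ (i ∷ w) ((_ , i≤n) ∷ isw) x≤1+n = s-≤ (s≤s i≤n) (apply-≤ w isw x≤1+n)

apply-take-suc : ∀ w t j → t < length w → apply (take (suc t) w) j ≡ apply (take t w) (s (at w (suc t)) j)
apply-take-suc (i ∷ w) zero    j _         = refl
apply-take-suc (i ∷ w) (suc t) j (s≤s t<∣w∣) = cong (s i) (apply-take-suc w t j t<∣w∣)

at-All : ∀ {P : ℕ → Set} w t → All P w → t < length w → P (at w (suc t))
at-All (i ∷ w) zero    (pi ∷ _)  _           = pi
at-All (i ∷ w) (suc t) (_  ∷ pw) (s≤s t<∣w∣) = at-All w t pw t<∣w∣

at≢0⇒≤length : ∀ w p → at w p ≢ 0 → p ≤ length w
at≢0⇒≤length []      p             at≢0 = ⊥-elim (at≢0 refl)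
at≢0⇒≤length (i ∷ w) zero          _    = z≤n
at≢0⇒≤length (i ∷ w) (suc zero)    _    = s≤s z≤n
at≢0⇒≤length (i ∷ w) (suc (suc p)) at≢0 = s≤s (at≢0⇒≤length w (suc p) at≢0)

χ< : ℕ → ℕ → ℕ
χ< y x with y <? x
... | yes _ = 1
... | no  _ = 0

χ<≤1 : ∀ y x → χ< y x ≤ 1
χ<≤1 y x with y <? x
... | yes _ = s≤s z≤n
... | no  _ = z≤n

χ<-yes : ∀ {y x} → y < x → χ< y x ≡ 1
χ<-yes {y} {x} y<x with y <? x
... | yes _  = refl
... | no y≮x = ⊥-elim (y≮x y<x)

χ<-no : ∀ {y x} → ¬ y < x → χ< y x ≡ 0
χ<-no {y} {x} y≮x with y <? x
... | yes y<x = ⊥-elim (y≮x y<x)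
... | no  _   = refl

below : ℕ → List ℕ → ℕ
below x []       = 0
below x (y ∷ ys) = χ< y x + below x ys

inversions : List ℕ → ℕ
inversions []       = 0
inversions (x ∷ xs) = below x xs + inversions xs

private
  applyUpTo-∘s-suc : ∀ (g : ℕ → ℕ) j m → applyUpTo (g ∘ s (suc j) ∘ suc) m ≡ applyUpTo (g ∘ suc ∘ s j) m
  applyUpTo-∘s-suc g j m = applyUpTo-cong m (λ k _ → cong g (s-suc j k))

-- applyUpTo (g ∘ s j) m is applyUpTo g m with the entries at 0-based indices j and j+1 exchanged.
below-swap : ∀ x (g : ℕ → ℕ) j m → suc (suc j) ≤ m → below x (applyUpTo (g ∘ s j) m) ≡ below x (applyUpTo g m)
below-swap x g zero    (suc (suc m)) _ = exchange (χ< (g 1) x) (χ< (g 0) x) _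
  where
  exchange : ∀ a b c → a + (b + c) ≡ b + (a + c)
  exchange = solve-∀
below-swap x g zero    (suc zero) (s≤s ())
below-swap x g (suc j) (suc m) (s≤s 2+j≤m) = cong (χ< (g 0) x +_) (begin
  below x (applyUpTo (g ∘ s (suc j) ∘ suc) m) ≡⟨ cong (below x) (applyUpTo-∘s-suc g j m) ⟩
  below x (applyUpTo (g ∘ suc ∘ s j) m)       ≡⟨ below-swap x (g ∘ suc) j m 2+j≤m ⟩
  below x (applyUpTo (g ∘ suc) m)             ∎)
  where open ≡-Reasoning

inversions-swap : ∀ (g : ℕ → ℕ) j m → suc (suc j) ≤ m →
                  inversions (applyUpTo (g ∘ s j) m) + χ< (g (suc j)) (g j) ≡ inversions (applyUpTo g m) + χ< (g j) (g (suc j))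
inversions-swap g zero (suc (suc m)) _ = exchange (χ< (g 0) (g 1)) (χ< (g 1) (g 0)) b₁ b₀ (inversions rest)
  where
  rest : List ℕ
  rest = applyUpTo (g ∘ suc ∘ suc) m
  b₀ b₁ : ℕ
  b₀ = below (g 0) rest
  b₁ = below (g 1) rest
  exchange : ∀ a b c d e → ((a + c) + (d + e)) + b ≡ ((b + d) + (c + e)) + a
  exchange = solve-∀
inversions-swap g zero (suc zero) (s≤s ())
inversions-swap g (suc j) (suc m) (s≤s 2+j≤m) = begin
  (below (g 0) swapped + inversions swapped) + χ    ≡⟨ cong (λ l → (below (g 0) l + inversions l) + χ) (applyUpTo-∘s-suc g j m) ⟩
  (below (g 0) swapped′ + inversions swapped′) + χ  ≡⟨ cong (λ c → (c + inversions swapped′) + χ) (below-swap (g 0) (g ∘ suc) j m 2+j≤m) ⟩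
  (b + inversions swapped′) + χ                     ≡⟨ +-assoc b _ χ ⟩
  b + (inversions swapped′ + χ)                     ≡⟨ cong (b +_) (inversions-swap (g ∘ suc) j m 2+j≤m) ⟩
  b + (inversions rest + χ′)                        ≡⟨ +-assoc b _ χ′ ⟨
  (b + inversions rest) + χ′                        ∎
  where
  open ≡-Reasoning
  swapped swapped′ rest : List ℕ
  swapped  = applyUpTo (g ∘ s (suc j) ∘ suc) m
  swapped′ = applyUpTo (g ∘ suc ∘ s j) m
  rest     = applyUpTo (g ∘ suc) m
  b χ χ′ : ℕ
  b        = below (g 0) rest
  χ        = χ< (g (suc (suc j))) (g (suc j))
  χ′       = χ< (g (suc j)) (g (suc (suc j)))

inversions-swap-≤ : ∀ (g : ℕ → ℕ) j m → suc (suc j) ≤ m →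
                    inversions (applyUpTo (g ∘ s j) m) ≤ suc (inversions (applyUpTo g m))
inversions-swap-≤ g j m 2+j≤m = begin
  inversions (applyUpTo (g ∘ s j) m)                            ≤⟨ m≤m+n _ _ ⟩
  inversions (applyUpTo (g ∘ s j) m) + χ< (g (suc j)) (g j)     ≡⟨ inversions-swap g j m 2+j≤m ⟩
  inversions (applyUpTo g m) + χ< (g j) (g (suc j))             ≤⟨ +-monoʳ-≤ _ (χ<≤1 (g j) (g (suc j))) ⟩
  inversions (applyUpTo g m) + 1                                ≡⟨ +-comm _ 1 ⟩
  suc (inversions (applyUpTo g m))                              ∎
  where open ≤-Reasoning

inversions-swap-descent : ∀ (g : ℕ → ℕ) j m → suc (suc j) ≤ m → g (suc j) < g j →
                          suc (inversions (applyUpTo (g ∘ s j) m)) ≡ inversions (applyUpTo g m)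
inversions-swap-descent g j m 2+j≤m descent = begin
  suc (inversions (applyUpTo (g ∘ s j) m))                      ≡⟨ +-comm 1 _ ⟩
  inversions (applyUpTo (g ∘ s j) m) + 1                        ≡⟨ cong (inversions (applyUpTo (g ∘ s j) m) +_) (χ<-yes descent) ⟨
  inversions (applyUpTo (g ∘ s j) m) + χ< (g (suc j)) (g j)     ≡⟨ inversions-swap g j m 2+j≤m ⟩
  inversions (applyUpTo g m) + χ< (g j) (g (suc j))             ≡⟨ cong (inversions (applyUpTo g m) +_) (χ<-no (<-asym descent)) ⟩
  inversions (applyUpTo g m) + 0                                ≡⟨ +-identityʳ _ ⟩
  inversions (applyUpTo g m)                                    ∎
  where open ≡-Reasoning

below-none : ∀ x (h : ℕ → ℕ) m → (∀ k → x ≤ h k) → below x (applyUpTo h m) ≡ 0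
below-none x h zero    x≤h = refl
below-none x h (suc m) x≤h = cong₂ _+_ (χ<-no (≤⇒≯ (x≤h 0))) (below-none x (h ∘ suc) m (x≤h ∘ suc))

below-all : ∀ x (h : ℕ → ℕ) m → (∀ k → h k < x) → below x (applyUpTo h m) ≡ m
below-all x h zero    h<x = refl
below-all x h (suc m) h<x = cong₂ _+_ (χ<-yes (h<x 0)) (below-all x (h ∘ suc) m (h<x ∘ suc))

inversions-monotone : ∀ (h : ℕ → ℕ) m → (∀ {a b} → a ≤ b → h a ≤ h b) → inversions (applyUpTo h m) ≡ 0
inversions-monotone h zero    mono = refl
inversions-monotone h (suc m) mono =
  cong₂ _+_ (below-none (h 0) (h ∘ suc) m (λ _ → mono z≤n)) (inversions-monotone (h ∘ suc) m (mono ∘ s≤s))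

triangle : ℕ → ℕ
triangle zero    = 0
triangle (suc m) = suc m + triangle m

inversions-reversed : ∀ m → inversions (applyUpTo (suc m ∸_) (suc m)) ≡ triangle m
inversions-reversed zero    = refl
inversions-reversed (suc m) =
  cong₂ _+_ (below-all (suc (suc m)) (suc m ∸_) (suc m) (λ k → s≤s (m∸n≤m (suc m) k))) (inversions-reversed m)

triangle*2 : ∀ m → triangle m * 2 ≡ m * suc m
triangle*2 zero    = refl
triangle*2 (suc m) = begin
  (suc m + triangle m) * 2         ≡⟨ *-distribʳ-+ 2 (suc m) (triangle m) ⟩
  suc m * 2 + triangle m * 2       ≡⟨ cong (suc m * 2 +_) (triangle*2 m) ⟩
  suc m * 2 + m * suc m            ≡⟨ lemma m ⟩
  suc m * suc (suc m)              ∎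
  where
  open ≡-Reasoning
  lemma : ∀ m → suc m * 2 + m * suc m ≡ suc m * suc (suc m)
  lemma = solve-∀

nbar≡triangle : ∀ n → nbar n ≡ triangle n
nbar≡triangle n = trans (cong (_/ 2) (sym (triangle*2 n))) (m*n/n≡m (triangle n) 2)

cycle : ℕ → List ℕ
cycle zero    = []
cycle (suc k) = cycle k ++ [ suc k ]

staircase : ℕ → List ℕ
staircase zero    = []
staircase (suc m) = cycle (suc m) ++ staircase m

apply-cycle-suc : ∀ k x → apply (cycle (suc k)) x ≡ apply (cycle k) (s (suc k) x)
apply-cycle-suc k x = apply-++ (cycle k) [ suc k ] x

apply-cycle-> : ∀ k {x} → suc k < x → apply (cycle k) x ≡ x
apply-cycle-> zero    _     = refl
apply-cycle-> (suc k) {x} 2+k<x = begin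
  apply (cycle (suc k)) x      ≡⟨ apply-cycle-suc k x ⟩
  apply (cycle k) (s (suc k) x) ≡⟨ cong (apply (cycle k)) (s-fixes (>⇒≢ (<-trans (n<1+n _) 2+k<x)) (>⇒≢ 2+k<x)) ⟩
  apply (cycle k) x            ≡⟨ apply-cycle-> k (<-trans (n<1+n _) 2+k<x) ⟩
  x                            ∎
  where open ≡-Reasoning

apply-cycle-top : ∀ k → apply (cycle k) (suc k) ≡ 1
apply-cycle-top zero    = refl
apply-cycle-top (suc k) = trans (apply-cycle-suc k (suc (suc k)))
  (trans (cong (apply (cycle k)) (s-at-suc-i (suc k))) (apply-cycle-top k))

apply-cycle-≤ : ∀ k {x} → 1 ≤ x → x ≤ k → apply (cycle k) x ≡ suc x
apply-cycle-≤ zero    1≤x x≤0 = ⊥-elim (<⇒≱ 1≤x x≤0)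
apply-cycle-≤ (suc k) {x} 1≤x x≤1+k with m≤n⇒m<n∨m≡n x≤1+k
... | inj₁ (s≤s x≤k) = begin
  apply (cycle (suc k)) x       ≡⟨ apply-cycle-suc k x ⟩
  apply (cycle k) (s (suc k) x) ≡⟨ cong (apply (cycle k)) (s-fixes (<⇒≢ (s≤s x≤k)) (<⇒≢ (<-trans (s≤s x≤k) (n<1+n _)))) ⟩
  apply (cycle k) x             ≡⟨ apply-cycle-≤ k 1≤x x≤k ⟩
  suc x                         ∎
  where open ≡-Reasoning
... | inj₂ refl = trans (apply-cycle-suc k (suc k))
  (trans (cong (apply (cycle k)) (s-at-i (suc k))) (apply-cycle-> k (n<1+n _)))

apply-staircase-> : ∀ m {x} → suc m < x → apply (staircase m) x ≡ x
apply-staircase-> zero    _     = refl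
apply-staircase-> (suc m) {x} 2+m<x = trans (apply-++ (cycle (suc m)) (staircase m) x)
  (trans (cong (apply (cycle (suc m))) (apply-staircase-> m (<-trans (n<1+n _) 2+m<x))) (apply-cycle-> (suc m) 2+m<x))

apply-staircase : ∀ m k → k ≤ m → apply (staircase m) (suc k) ≡ suc m ∸ k
apply-staircase zero    zero _ = refl
apply-staircase (suc m) k k≤1+m with m≤n⇒m<n∨m≡n k≤1+m
... | inj₁ (s≤s k≤m) = begin
  apply (staircase (suc m)) (suc k)                   ≡⟨ apply-++ (cycle (suc m)) (staircase m) (suc k) ⟩
  apply (cycle (suc m)) (apply (staircase m) (suc k)) ≡⟨ cong (apply (cycle (suc m))) (apply-staircase m k k≤m) ⟩
  apply (cycle (suc m)) (suc m ∸ k)                   ≡⟨ cong (apply (cycle (suc m))) (+-∸-assoc 1 k≤m) ⟩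
  apply (cycle (suc m)) (suc (m ∸ k))                 ≡⟨ apply-cycle-≤ (suc m) (s≤s z≤n) (s≤s (m∸n≤m m k)) ⟩
  suc (suc (m ∸ k))                                   ≡⟨ cong suc (sym (+-∸-assoc 1 k≤m)) ⟩
  suc (suc m ∸ k)                                     ≡⟨ sym (+-∸-assoc 1 k≤1+m) ⟩
  suc (suc m) ∸ k                                     ∎
  where open ≡-Reasoning
... | inj₂ refl = begin
  apply (staircase (suc m)) (suc (suc m))                   ≡⟨ apply-++ (cycle (suc m)) (staircase m) (suc (suc m)) ⟩
  apply (cycle (suc m)) (apply (staircase m) (suc (suc m))) ≡⟨ cong (apply (cycle (suc m))) (apply-staircase-> m (n<1+n _)) ⟩
  apply (cycle (suc m)) (suc (suc m))                       ≡⟨ apply-cycle-top (suc m) ⟩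
  1                                                         ≡⟨ sym (m+n∸n≡m 1 (suc m)) ⟩
  suc (suc m) ∸ suc m                                       ∎
  where open ≡-Reasoning

length-cycle : ∀ k → length (cycle k) ≡ k
length-cycle zero    = refl
length-cycle (suc k) = trans (List.length-++ (cycle k)) (trans (cong (_+ 1) (length-cycle k)) (+-comm k 1))

length-staircase : ∀ m → length (staircase m) ≡ triangle m
length-staircase zero    = refl
length-staircase (suc m) = trans (List.length-++ (cycle (suc m))) (cong₂ _+_ (length-cycle (suc m)) (length-staircase m))

cycle-isWord : ∀ {n} k → k ≤ n → IsWord n (cycle k)
cycle-isWord zero    _     = []
cycle-isWord (suc k) 1+k≤n = All.++⁺ (cycle-isWord k (<⇒≤ 1+k≤n)) ((s≤s z≤n , 1+k≤n) ∷ [])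

staircase-isWord : ∀ {n} m → m ≤ n → IsWord n (staircase m)
staircase-isWord zero    _     = []
staircase-isWord (suc m) 1+m≤n = All.++⁺ (cycle-isWord (suc m) 1+m≤n) (staircase-isWord m (<⇒≤ 1+m≤n))

oneLine-staircase : ∀ n → oneLine n (staircase n) ≡ w0 n
oneLine-staircase n = begin
  oneLine n (staircase n)                                  ≡⟨ oneLine-applyUpTo n (staircase n) ⟩
  applyUpTo (λ k → apply (staircase n) (suc k)) (suc n)    ≡⟨ applyUpTo-cong (suc n) (λ k k<1+n → apply-staircase n k (m<1+n⇒m≤n k<1+n)) ⟩
  applyUpTo (suc n ∸_) (suc n)                             ≡⟨ sym (List.map-upTo (suc n ∸_) (suc n)) ⟩
  w0 n                                                     ∎
  where open ≡-Reasoning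

stepwise-monotone : ∀ (f : ℕ → ℕ) N → (∀ t → t < N → f t ≤ f (suc t)) →
                    ∀ {t t′} → t ≤ t′ → t′ ≤ N → f t ≤ f t′
stepwise-monotone f N step {t′ = zero}  z≤n _ = ≤-refl
stepwise-monotone f N step {t′ = suc u} t≤1+u 1+u≤N with m≤n⇒m<n∨m≡n t≤1+u
... | inj₂ refl      = ≤-refl
... | inj₁ (s≤s t≤u) = ≤-trans (stepwise-monotone f N step t≤u (<⇒≤ 1+u≤N)) (step u 1+u≤N)

upcrossing : ∀ (f : ℕ → ℕ) {c} N → f 0 ≤ c → c < f N → Σ ℕ λ t → t < N × f t ≤ c × c < f (suc t)
upcrossing f zero    f₀≤c c<f₀ = ⊥-elim (<⇒≱ c<f₀ f₀≤c)
upcrossing f {c} (suc N) f₀≤c c<f[1+N] with c <? f N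
... | no  c≮f[N] = N , n<1+n N , ≮⇒≥ c≮f[N] , c<f[1+N]
... | yes c<f[N] with upcrossing f N f₀≤c c<f[N]
...   | t , t<N , crossing = t , <-trans t<N (n<1+n N) , crossing

unit-increments : ∀ (f : ℕ → ℕ) N → f 0 ≡ 0 → (∀ t → t < N → f (suc t) ≤ suc (f t)) → N ≤ f N →
                  ∀ t → t < N → f (suc t) ≡ suc (f t)
unit-increments f N f₀≡0 step N≤f[N] t t<N = ≤-antisym (step t t<N) (≰⇒> stalls⇒⊥)
  where
  growth : ∀ k t → t + k ≤ N → f (t + k) ≤ f t + k
  growth zero    t _        = ≤-reflexive (trans (cong f (+-identityʳ t)) (sym (+-identityʳ (f t))))
  growth (suc k) t t+1+k≤N  = begin
    f (t + suc k)   ≡⟨ cong f (+-suc t k) ⟩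
    f (suc (t + k)) ≤⟨ step (t + k) (subst (_≤ N) (+-suc t k) t+1+k≤N) ⟩
    suc (f (t + k)) ≤⟨ s≤s (growth k t (≤-trans (+-monoʳ-≤ t (n≤1+n k)) t+1+k≤N)) ⟩
    suc (f t + k)   ≡⟨ sym (+-suc (f t) k) ⟩
    f t + suc k     ∎
    where open ≤-Reasoning

  f≤id : ∀ t → t ≤ N → f t ≤ t
  f≤id t t≤N = subst₂ _≤_ (cong f (+-identityˡ t)) (cong (_+ t) f₀≡0) (growth t 0 t≤N)

  stalls⇒⊥ : ¬ f (suc t) ≤ f t
  stalls⇒⊥ stall = <-irrefl refl (begin-strict
    N                   ≤⟨ N≤f[N] ⟩
    f N                 ≡⟨ cong f (sym (m+[n∸m]≡n t<N)) ⟩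
    f (suc t + k)       ≤⟨ growth k (suc t) (≤-reflexive (m+[n∸m]≡n t<N)) ⟩
    f (suc t) + k       ≤⟨ +-monoˡ-≤ k (≤-trans stall (f≤id t (<⇒≤ t<N))) ⟩
    t + k               <⟨ n<1+n (t + k) ⟩
    suc t + k           ≡⟨ m+[n∸m]≡n t<N ⟩
    N                   ∎)
    where
    open ≤-Reasoning
    k : ℕ
    k = N ∸ suc t

orbit : (ℕ → ℕ) → ℕ → ℕ → ℕ
orbit ℓ x zero    = x
orbit ℓ x (suc t) = s (ℓ t) (orbit ℓ x t)

orbit-≤ : ∀ {m T} (ℓ : ℕ → ℕ) {x} → (∀ t → t < T → ℓ t < m) → x ≤ m → ∀ t → t ≤ T → orbit ℓ x t ≤ m
orbit-≤ ℓ ℓ<m x≤m zero    _       = x≤m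
orbit-≤ ℓ ℓ<m x≤m (suc t) 1+t≤T = s-≤ (ℓ<m t 1+t≤T) (orbit-≤ ℓ ℓ<m x≤m t (<⇒≤ 1+t≤T))

reflect-orbit : ∀ {m T} (ℓ : ℕ → ℕ) {x} → (∀ t → t < T → ℓ t < m) → x ≤ m → ∀ t → t ≤ T →
                m ∸ orbit ℓ x t ≡ orbit (λ t → m ∸ suc (ℓ t)) (m ∸ x) t
reflect-orbit ℓ ℓ<m x≤m zero    _     = refl
reflect-orbit ℓ ℓ<m x≤m (suc t) 1+t≤T =
  trans (reflect-s (ℓ<m t 1+t≤T) (orbit-≤ ℓ ℓ<m x≤m t (<⇒≤ 1+t≤T)))
        (cong (s _) (reflect-orbit ℓ ℓ<m x≤m t (<⇒≤ 1+t≤T)))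

index-of-positive : ∀ {x n} → 1 ≤ x → x ≤ n → Σ (Fin n) λ k → suc (toℕ k) ≡ x
index-of-positive {suc x} _ x<n = fromℕ< x<n , cong suc (Fin.toℕ-fromℕ< x<n)

-- The 0-based counterpart of IsSubseqPositions: at time t the letter ℓ t is read.
record IsSubseqTimes {n : ℕ} (N : ℕ) (ℓ : ℕ → ℕ) (target T : Fin n → ℕ) : Set where
  field
    bounded    : ∀ k → T k < N
    increasing : ∀ k l → toℕ k < toℕ l → T k < T l
    letters    : ∀ k → ℓ (T k) ≡ target k

-- As the orbit of 1 never moves down, it rises by one exactly at the times t when ℓ t equals its current height.
module Climb {n N : ℕ} (ℓ : ℕ → ℕ)
             (ℓ-range : ∀ t → t < N → 1 ≤ ℓ t × ℓ t ≤ n)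
             (reaches-top : orbit ℓ 1 N ≡ suc n)
             (never-down : ∀ t → t < N → suc (ℓ t) ≢ orbit ℓ 1 t) where

  height : ℕ → ℕ
  height = orbit ℓ 1

  Climbs : ℕ → Set
  Climbs t = ℓ t ≡ height t

  climb-step : ∀ {t} → Climbs t → height (suc t) ≡ suc (height t)
  climb-step {t} climbs = trans (cong (s (ℓ t)) (sym climbs)) (trans (s-at-i (ℓ t)) (cong suc climbs))

  rest-step : ∀ {t} → t < N → ¬ Climbs t → height (suc t) ≡ height t
  rest-step {t} t<N rests = s-fixes (rests ∘ sym) (never-down t t<N ∘ sym)

  height-step-≤ : ∀ t → t < N → height t ≤ height (suc t)
  height-step-≤ t t<N with ℓ t ≟ height t
  ... | yes climbs = subst (height t ≤_) (sym (climb-step climbs)) (n≤1+n _)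
  ... | no  rests  = ≤-reflexive (sym (rest-step t<N rests))

  height-step-≤suc : ∀ t → t < N → height (suc t) ≤ suc (height t)
  height-step-≤suc t t<N with ℓ t ≟ height t
  ... | yes climbs = ≤-reflexive (climb-step climbs)
  ... | no  rests  = subst (_≤ suc (height t)) (sym (rest-step t<N rests)) (n≤1+n _)

  height-mono : ∀ {t t′} → t ≤ t′ → t′ ≤ N → height t ≤ height t′
  height-mono = stepwise-monotone height N height-step-≤

  climb-lower : ∀ {t} → t < N → ℓ t ≤ height t → suc (ℓ t) ≤ height (suc t)
  climb-lower {t} t<N ℓ≤h with ℓ t ≟ height t
  ... | yes climbs = subst (suc (ℓ t) ≤_) (sym (climb-step climbs)) (s≤s ℓ≤h)
  ... | no  rests  = subst (suc (ℓ t) ≤_) (sym (rest-step t<N rests)) (≤∧≢⇒< ℓ≤h rests)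

  climb-upper : ∀ {t} → t < N → height (suc t) ≤ suc (ℓ t) → height t ≤ ℓ t
  climb-upper {t} t<N h≤1+ℓ =
    m<1+n⇒m≤n (≤∧≢⇒< (≤-trans (height-step-≤ t t<N) h≤1+ℓ) (never-down t t<N ∘ sym))

  climb-at : ∀ c → 1 ≤ c → c ≤ n → Σ ℕ λ t → t < N × Climbs t × height t ≡ c
  climb-at c 1≤c c≤n with upcrossing height N 1≤c (subst (c <_) (sym reaches-top) (s≤s c≤n))
  ... | t , t<N , h≤c , c<h[1+t] with ℓ t ≟ height t
  ...   | no  rests  = ⊥-elim (<⇒≱ c<h[1+t] (subst (_≤ c) (sym (rest-step t<N rests)) h≤c))
  ...   | yes climbs = t , t<N , climbs , ≤-antisym h≤c (m<1+n⇒m≤n (subst (c <_) (climb-step climbs) c<h[1+t]))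

  climb-raises : ∀ {t t′} → Climbs t → t < t′ → t′ ≤ N → height t < height t′
  climb-raises climbs t<t′ t′≤N = subst (_≤ _) (climb-step climbs) (height-mono t<t′ t′≤N)

  climb-unique : ∀ {t t′} → t < N → t′ < N → Climbs t → Climbs t′ → height t ≡ height t′ → t ≡ t′
  climb-unique {t} {t′} t<N t′<N climbs climbs′ same with <-cmp t t′
  ... | tri≈ _ t≡t′ _ = t≡t′
  ... | tri< t<t′ _ _ = ⊥-elim (<-irrefl same (climb-raises climbs t<t′ (<⇒≤ t′<N)))
  ... | tri> _ _ t′<t = ⊥-elim (<-irrefl (sym same) (climb-raises climbs′ t′<t (<⇒≤ t<N)))

  private
    climb-at-index : ∀ (k : Fin n) → Σ ℕ λ t → t < N × Climbs t × height t ≡ suc (toℕ k)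
    climb-at-index k = climb-at (suc (toℕ k)) (s≤s z≤n) (Fin.toℕ<n k)

  climbTime : Fin n → ℕ
  climbTime k = proj₁ (climb-at-index k)

  climbTime-< : ∀ k → climbTime k < N
  climbTime-< k = proj₁ (proj₂ (climb-at-index k))

  climbTime-climbs : ∀ k → Climbs (climbTime k)
  climbTime-climbs k = proj₁ (proj₂ (proj₂ (climb-at-index k)))

  height-climbTime : ∀ k → height (climbTime k) ≡ suc (toℕ k)
  height-climbTime k = proj₂ (proj₂ (proj₂ (climb-at-index k)))

  climbTime-injective : ∀ {k l} → climbTime k ≡ climbTime l → k ≡ l
  climbTime-injective {k} {l} same = Fin.toℕ-injective (suc-injective
    (trans (sym (height-climbTime k)) (trans (cong height same) (height-climbTime l))))

  climb⇒climbTime : ∀ {t} → t < N → Climbs t → Σ (Fin n) λ k → climbTime k ≡ t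
  climb⇒climbTime {t} t<N climbs with index-of-positive (proj₁ (ℓ-range t t<N)) (proj₂ (ℓ-range t t<N))
  ... | k , 1+k≡ℓ = k , climb-unique (climbTime-< k) t<N (climbTime-climbs k) climbs
                          (trans (height-climbTime k) (trans 1+k≡ℓ climbs))

  climbTimes : IsSubseqTimes N ℓ (suc ∘ toℕ) climbTime
  climbTimes = record
    { bounded    = climbTime-<
    ; increasing = λ k l k<l → ≰⇒> λ l≤k → <⇒≱ (s≤s k<l)
        (subst₂ _≤_ (height-climbTime l) (height-climbTime k) (height-mono l≤k (<⇒≤ (climbTime-< k))))
    ; letters    = λ k → trans (climbTime-climbs k) (height-climbTime k)
    }

  module _ {T : Fin n → ℕ} (times : IsSubseqTimes N ℓ (suc ∘ toℕ) T) where
    open IsSubseqTimes times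

    private
      Tℕ : ∀ j → j < n → ℕ
      Tℕ j j<n = T (fromℕ< j<n)

      Tℕ-< : ∀ j (j<n : j < n) → Tℕ j j<n < N
      Tℕ-< j j<n = bounded (fromℕ< j<n)

      ℓ-Tℕ : ∀ j (j<n : j < n) → ℓ (Tℕ j j<n) ≡ suc j
      ℓ-Tℕ j j<n = trans (letters (fromℕ< j<n)) (cong suc (Fin.toℕ-fromℕ< j<n))

      Tℕ-next : ∀ j (1+j<n : suc j < n) → Tℕ j (<-trans (n<1+n j) 1+j<n) < Tℕ (suc j) 1+j<n
      Tℕ-next j 1+j<n = increasing _ _ (subst₂ _<_ (sym (Fin.toℕ-fromℕ< _)) (sym (Fin.toℕ-fromℕ< 1+j<n)) (n<1+n j))

      -- The height at the j-th letter is squeezed to j+1: count climbs from the start for the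
      -- lower bound and from the end, where the height is n+1, for the upper bound.
      lower : ∀ j (j<n : j < n) → suc j ≤ height (Tℕ j j<n)
      lower zero    j<n   = height-mono z≤n (<⇒≤ (Tℕ-< 0 j<n))
      lower (suc j) 1+j<n = begin
        suc (suc j)                 ≡⟨ cong suc (sym (ℓ-Tℕ j j<n)) ⟩
        suc (ℓ (Tℕ j j<n))          ≤⟨ climb-lower (Tℕ-< j j<n) (subst (_≤ height (Tℕ j j<n)) (sym (ℓ-Tℕ j j<n)) (lower j j<n)) ⟩
        height (suc (Tℕ j j<n))     ≤⟨ height-mono (Tℕ-next j 1+j<n) (<⇒≤ (Tℕ-< (suc j) 1+j<n)) ⟩
        height (Tℕ (suc j) 1+j<n)   ∎
        where
        open ≤-Reasoning
        j<n : j < n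
        j<n = <-trans (n<1+n j) 1+j<n

      upper-from-next : ∀ j (j<n : j < n) → height (suc (Tℕ j j<n)) ≤ suc (suc j) → height (Tℕ j j<n) ≤ suc j
      upper-from-next j j<n h≤ = subst (height (Tℕ j j<n) ≤_) (ℓ-Tℕ j j<n)
        (climb-upper (Tℕ-< j j<n) (subst (λ x → height (suc (Tℕ j j<n)) ≤ suc x) (sym (ℓ-Tℕ j j<n)) h≤))

      upper : ∀ m j (j<n : j < n) → suc j + m ≡ n → height (Tℕ j j<n) ≤ suc j
      upper zero j j<n 1+j+0≡n = upper-from-next j j<n (begin
        height (suc (Tℕ j j<n)) ≤⟨ height-mono (Tℕ-< j j<n) ≤-refl ⟩
        height N                ≡⟨ reaches-top ⟩
        suc n                   ≡⟨ cong suc (sym (trans (sym (+-identityʳ (suc j))) 1+j+0≡n)) ⟩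
        suc (suc j)             ∎)
        where open ≤-Reasoning
      upper (suc m) j j<n 1+j+1+m≡n = upper-from-next j j<n (begin
        height (suc (Tℕ j j<n))   ≤⟨ height-mono (Tℕ-next j 1+j<n) (<⇒≤ (Tℕ-< (suc j) 1+j<n)) ⟩
        height (Tℕ (suc j) 1+j<n) ≤⟨ upper m (suc j) 1+j<n 2+j+m≡n ⟩
        suc (suc j)               ∎)
        where
        open ≤-Reasoning
        2+j+m≡n : suc (suc j) + m ≡ n
        2+j+m≡n = trans (sym (+-suc (suc j) m)) 1+j+1+m≡n
        1+j<n : suc j < n
        1+j<n = subst (suc j <_) 2+j+m≡n (s≤s (m≤m+n (suc j) m))

    subseq-height : ∀ k → height (T k) ≡ suc (toℕ k)
    subseq-height k = subst (λ k′ → height (T k′) ≡ suc (toℕ k)) (Fin.fromℕ<-toℕ k j<n)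
      (≤-antisym (upper (n ∸ suc j) j j<n (m+[n∸m]≡n j<n)) (lower j j<n))
      where
      j : ℕ
      j = toℕ k
      j<n : j < n
      j<n = Fin.toℕ<n k

    climbTimes-unique : ∀ k → T k ≡ climbTime k
    climbTimes-unique k = climb-unique (bounded k) (climbTime-< k) (trans (letters k) (sym (subseq-height k)))
      (climbTime-climbs k) (trans (subseq-height k) (sym (height-climbTime k)))

count-tabulate-unique : ∀ {a p} {A : Set a} {P : Pred A p} (P? : Decidable P) {m} (f : Fin m → A) k₀ →
                        P (f k₀) → (∀ k → P (f k) → k ≡ k₀) → length (filter P? (tabulate f)) ≡ 1
count-tabulate-unique P? f Fin.zero Pf₀ only = begin
    length (filter P? (tabulate f))              ≡⟨ cong length (List.filter-accept P? Pf₀) ⟩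
    suc (length (filter P? (tabulate (f ∘ Fin.suc)))) ≡⟨ cong (suc ∘ length) (List.filter-none P? (All.tabulate⁺ λ k Pf → Fin.0≢1+n (sym (only (Fin.suc k) Pf)))) ⟩
    1                                            ∎
  where open ≡-Reasoning
count-tabulate-unique P? f (Fin.suc k₀) Pf₀ only = trans
  (cong length (List.filter-reject P? λ Pf → Fin.0≢1+n (only Fin.zero Pf)))
  (count-tabulate-unique P? (f ∘ Fin.suc) k₀ Pf₀ (λ k Pf → Fin.suc-injective (only (Fin.suc k) Pf)))

positions-suc-pred : ∀ {n M} word {target a : Fin n → ℕ} → IsSubseqPositions M word target a →
                     ∀ k → suc (pred (a k)) ≡ a k
positions-suc-pred word (in-range , _) k = suc-pred _ ⦃ >-nonZero (proj₁ (in-range k)) ⦄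

positions⇒times : ∀ {n M} word {target a : Fin n → ℕ} → (∀ k → target k ≢ 0) → IsSubseqPositions M word target a →
                  IsSubseqTimes (length word) (λ t → at word (suc t)) target (pred ∘ a)
positions⇒times word {target} {a} target≢0 positions@(in-range , a-increasing , a-letters) = record
  { bounded    = λ k → subst (_≤ length word) (sym (positions-suc-pred word positions k))
                   (at≢0⇒≤length word (a k) (λ at≡0 → target≢0 k (trans (sym (a-letters k)) at≡0)))
  ; increasing = λ k l k<l → pred-mono-< ⦃ >-nonZero (proj₁ (in-range k)) ⦄ (a-increasing k l k<l)
  ; letters    = λ k → trans (cong (at word) (positions-suc-pred word positions k)) (a-letters k)
  }

times⇒positions : ∀ {n M} word {target T : Fin n → ℕ} → length word ≤ M →
                  IsSubseqTimes (length word) (λ t → at word (suc t)) target T → IsSubseqPositions M word target (suc ∘ T)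
times⇒positions word ∣word∣≤M times =
  (λ k → s≤s z≤n , ≤-trans (bounded k) ∣word∣≤M) , (λ k l k<l → s<s (increasing k l k<l)) , letters
  where open IsSubseqTimes times

module ReducedWordOfLongest (n : ℕ) (n≥1 : 1 ≤ n) (word : List ℕ) (reduced : IsReducedWord n (w0 n) word) where

  N : ℕ
  N = length word

  ℓ : ℕ → ℕ
  ℓ t = at word (suc t)

  prefix : ℕ → ℕ → ℕ
  prefix t = apply (take t word)

  isWord : IsWord n word
  isWord = proj₁ reduced

  ℓ-range : ∀ t → t < N → 1 ≤ ℓ t × ℓ t ≤ n
  ℓ-range t t<N = at-All word t isWord t<N

  prefix-step : ∀ {t} x → t < N → prefix (suc t) x ≡ prefix t (s (ℓ t) x)
  prefix-step x t<N = apply-take-suc word _ x t<N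

  prefix-N : ∀ x → prefix N x ≡ apply word x
  prefix-N x = cong (λ w → apply w x) (List.take-all N word ≤-refl)

  word-entry : ∀ k → k ≤ n → apply word (suc k) ≡ suc n ∸ k
  word-entry k k≤n = applyUpTo-cong⁻ {λ k → apply word (suc k)} {suc n ∸_} (suc n) (begin
    applyUpTo (λ k → apply word (suc k)) (suc n) ≡⟨ sym (oneLine-applyUpTo n word) ⟩
    oneLine n word                               ≡⟨ proj₁ (proj₂ reduced) ⟩
    w0 n                                         ≡⟨ List.map-upTo (suc n ∸_) (suc n) ⟩
    applyUpTo (suc n ∸_) (suc n)                 ∎) k (s≤s k≤n)
    where open ≡-Reasoning

  oneLineEntry : ℕ → ℕ → ℕ
  oneLineEntry t k = prefix t (suc k)

  prefixInversions : ℕ → ℕ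
  prefixInversions t = inversions (applyUpTo (oneLineEntry t) (suc n))

  oneLineEntry-step : ∀ {t j} → t < N → ℓ t ≡ suc j → applyUpTo (oneLineEntry (suc t)) (suc n) ≡ applyUpTo (oneLineEntry t ∘ s j) (suc n)
  oneLineEntry-step {t} {j} t<N ℓ≡1+j = applyUpTo-cong (suc n) λ k _ →
    trans (prefix-step (suc k) t<N) (cong (prefix t) (trans (cong (λ i → s i (suc k)) ℓ≡1+j) (s-suc j k)))

  letter-index : ∀ t → t < N → Σ ℕ λ j → ℓ t ≡ suc j × suc (suc j) ≤ suc n
  letter-index t t<N with index-of-positive (proj₁ (ℓ-range t t<N)) (proj₂ (ℓ-range t t<N))
  ... | k , 1+k≡ℓ = toℕ k , sym 1+k≡ℓ , s≤s (Fin.toℕ<n k)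

  prefixInversions-step-≤ : ∀ t → t < N → prefixInversions (suc t) ≤ suc (prefixInversions t)
  prefixInversions-step-≤ t t<N with letter-index t t<N
  ... | j , ℓ≡1+j , 2+j≤1+n =
    subst (_≤ suc (prefixInversions t)) (cong inversions (sym (oneLineEntry-step t<N ℓ≡1+j)))
          (inversions-swap-≤ (oneLineEntry t) j (suc n) 2+j≤1+n)

  prefixInversions-step-descent : ∀ t → t < N → prefix t (suc (ℓ t)) < prefix t (ℓ t) →
                                  suc (prefixInversions (suc t)) ≡ prefixInversions t
  prefixInversions-step-descent t t<N descent with letter-index t t<N
  ... | j , ℓ≡1+j , 2+j≤1+n =
    subst (λ l → suc (inversions l) ≡ prefixInversions t) (sym (oneLineEntry-step t<N ℓ≡1+j))
          (inversions-swap-descent (oneLineEntry t) j (suc n) 2+j≤1+n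
            (subst (λ i → prefix t (suc i) < prefix t i) ℓ≡1+j descent))

  prefixInversions-0 : prefixInversions 0 ≡ 0
  prefixInversions-0 = inversions-monotone suc (suc n) s≤s

  prefixInversions-N : prefixInversions N ≡ triangle n
  prefixInversions-N = trans
    (cong inversions (applyUpTo-cong (suc n) λ k k<1+n → trans (prefix-N (suc k)) (word-entry k (m<1+n⇒m≤n k<1+n))))
    (inversions-reversed n)

  N≤triangle : N ≤ triangle n
  N≤triangle = subst (N ≤_) (length-staircase n)
    (proj₂ (proj₂ reduced) (staircase n) (staircase-isWord n ≤-refl) (oneLine-staircase n))

  ascent : ∀ t → t < N → prefix t (ℓ t) < prefix t (suc (ℓ t))
  ascent t t<N = ≤∧≢⇒< (≮⇒≥ descent⇒⊥) (λ same → 1+n≢n (sym (apply-injective (take t word) same)))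
    where
    descent⇒⊥ : ¬ prefix t (suc (ℓ t)) < prefix t (ℓ t)
    descent⇒⊥ descent = <-irrefl (sym (trans (cong suc (sym grows)) (prefixInversions-step-descent t t<N descent)))
                                   (m<n⇒m<1+n (n<1+n _))
      where
      grows : prefixInversions (suc t) ≡ suc (prefixInversions t)
      grows = unit-increments prefixInversions N prefixInversions-0 prefixInversions-step-≤
                (subst (N ≤_) (sym prefixInversions-N) N≤triangle) t t<N

  orbit-prefix : ∀ x t → t ≤ N → prefix t (orbit ℓ x t) ≡ x
  orbit-prefix x zero    _     = refl
  orbit-prefix x (suc t) 1+t≤N = trans (prefix-step _ 1+t≤N)
    (trans (cong (prefix t) (s-involutive (ℓ t) _)) (orbit-prefix x t (<⇒≤ 1+t≤N)))

  -- P t and Q t are the places of the values 1 and n+1 in the one-line notation of prefix t.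
  P Q : ℕ → ℕ
  P = orbit ℓ 1
  Q = orbit ℓ (suc n)

  P-top : P N ≡ suc n
  P-top = apply-injective word (begin
    apply word (P N)      ≡⟨ sym (prefix-N (P N)) ⟩
    prefix N (P N)        ≡⟨ orbit-prefix 1 N ≤-refl ⟩
    1                     ≡⟨ sym (m+n∸n≡m 1 n) ⟩
    suc n ∸ n             ≡⟨ sym (word-entry n ≤-refl) ⟩
    apply word (suc n)    ∎)
    where open ≡-Reasoning

  Q-bottom : Q N ≡ 1
  Q-bottom = apply-injective word
    (trans (sym (prefix-N (Q N))) (trans (orbit-prefix (suc n) N ≤-refl) (sym (word-entry 0 z≤n))))

  P-never-down : ∀ t → t < N → suc (ℓ t) ≢ P t
  P-never-down t t<N 1+ℓ≡P = <⇒≢ (proj₁ (ℓ-range t t<N)) (sym (apply-injective (take t word) (begin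
    prefix t (ℓ t) ≡⟨ n<1⇒n≡0 (subst (prefix t (ℓ t) <_) value-1 (ascent t t<N)) ⟩
    0              ≡⟨ sym (apply-zero (take t word) (All.take⁺ t isWord)) ⟩
    prefix t 0     ∎)))
    where
    open ≡-Reasoning
    value-1 : prefix t (suc (ℓ t)) ≡ 1
    value-1 = trans (cong (prefix t) 1+ℓ≡P) (orbit-prefix 1 t (<⇒≤ t<N))

  Q-never-up : ∀ t → t < N → ℓ t ≢ Q t
  Q-never-up t t<N ℓ≡Q = <-irrefl refl (begin-strict
    suc n                  ≡⟨ sym (orbit-prefix (suc n) t (<⇒≤ t<N)) ⟩
    prefix t (Q t)         ≡⟨ cong (prefix t) (sym ℓ≡Q) ⟩
    prefix t (ℓ t)         <⟨ ascent t t<N ⟩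
    prefix t (suc (ℓ t))   ≤⟨ apply-≤ (take t word) (All.take⁺ t isWord) (s≤s (proj₂ (ℓ-range t t<N))) ⟩
    suc n                  ∎)
    where open ≤-Reasoning

  -- Reflecting x ↦ n+2 ∸ x turns the descent of Q into a climb of Q′ under the letters ℓ′.
  ℓ′ : ℕ → ℕ
  ℓ′ t = suc n ∸ ℓ t

  Q′ : ℕ → ℕ
  Q′ = orbit ℓ′ 1

  ℓ≤1+n : ∀ t → t < N → ℓ t ≤ suc n
  ℓ≤1+n t t<N = m≤n⇒m≤1+n (proj₂ (ℓ-range t t<N))

  ℓ<2+n : ∀ t → t < N → ℓ t < suc (suc n)
  ℓ<2+n t t<N = s≤s (ℓ≤1+n t t<N)

  Q≤2+n : ∀ t → t ≤ N → Q t ≤ suc (suc n)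
  Q≤2+n = orbit-≤ ℓ ℓ<2+n (n≤1+n _)

  Q′≡reflected-Q : ∀ t → t ≤ N → Q′ t ≡ suc (suc n) ∸ Q t
  Q′≡reflected-Q t t≤N = sym (trans (reflect-orbit ℓ ℓ<2+n (n≤1+n _) t t≤N)
                                    (cong (λ x → orbit ℓ′ x t) (m+n∸n≡m 1 (suc n))))

  ℓ′-range : ∀ t → t < N → 1 ≤ ℓ′ t × ℓ′ t ≤ n
  ℓ′-range t t<N with ℓ t | ℓ-range t t<N
  ... | suc i | _ , 1+i≤n = m<n⇒0<n∸m 1+i≤n , m∸n≤m n i

  Q′-top : Q′ N ≡ suc n
  Q′-top = trans (Q′≡reflected-Q N ≤-refl) (cong (suc (suc n) ∸_) Q-bottom)

  Q′-never-down : ∀ t → t < N → suc (ℓ′ t) ≢ Q′ t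
  Q′-never-down t t<N 1+ℓ′≡Q′ = Q-never-up t t<N (∸-cancelˡ-≡ (<⇒≤ (ℓ<2+n t t<N)) (Q≤2+n t (<⇒≤ t<N)) (begin
    suc (suc n) ∸ ℓ t   ≡⟨ +-∸-assoc 1 (ℓ≤1+n t t<N) ⟩
    suc (ℓ′ t)          ≡⟨ 1+ℓ′≡Q′ ⟩
    Q′ t                ≡⟨ Q′≡reflected-Q t (<⇒≤ t<N) ⟩
    suc (suc n) ∸ Q t   ∎))
    where open ≡-Reasoning

  module Up   = Climb ℓ  ℓ-range  P-top  P-never-down
  module Down = Climb ℓ′ ℓ′-range Q′-top Q′-never-down

  mirror-times : ∀ {T : Fin n → ℕ} → IsSubseqTimes N ℓ (λ k → n ∸ toℕ k) T → IsSubseqTimes N ℓ′ (suc ∘ toℕ) T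
  mirror-times times = record
    { bounded    = bounded
    ; increasing = increasing
    ; letters    = λ k → trans (cong (suc n ∸_) (letters k)) (m∸[m∸n]≡n (s≤s (<⇒≤ (Fin.toℕ<n k))))
    }
    where open IsSubseqTimes times

  unmirror-times : ∀ {T : Fin n → ℕ} → IsSubseqTimes N ℓ′ (suc ∘ toℕ) T → IsSubseqTimes N ℓ (λ k → n ∸ toℕ k) T
  unmirror-times times = record
    { bounded    = bounded
    ; increasing = increasing
    ; letters    = λ k → trans (sym (m∸[m∸n]≡n (ℓ≤1+n _ (bounded k)))) (cong (suc n ∸_) (letters k))
    }
    where open IsSubseqTimes times

  N≤nbar : N ≤ nbar n
  N≤nbar = subst (N ≤_) (sym (nbar≡triangle n)) N≤triangle

  IsAscendingPositions IsDescendingPositions : (Fin n → ℕ) → Set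
  IsAscendingPositions = IsSubseqPositions (nbar n) word (λ k → suc (toℕ k))
  IsDescendingPositions = IsSubseqPositions (nbar n) word (λ k → n ∸ toℕ k)

  a d : Fin n → ℕ
  a k = suc (Up.climbTime k)
  d k = suc (Down.climbTime k)

  a-positions : IsAscendingPositions a
  a-positions = times⇒positions word N≤nbar Up.climbTimes

  d-positions : IsDescendingPositions d
  d-positions = times⇒positions word N≤nbar (unmirror-times Down.climbTimes)

  a-unique : ∀ a′ → IsAscendingPositions a′ → ∀ k → a′ k ≡ a k
  a-unique a′ positions k = trans (sym (positions-suc-pred word positions k))
    (cong suc (Up.climbTimes-unique (positions⇒times word (λ _ ()) positions) k))

  d-unique : ∀ d′ → IsDescendingPositions d′ → ∀ k → d′ k ≡ d k
  d-unique d′ positions k = trans (sym (positions-suc-pred word positions k))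
    (cong suc (Down.climbTimes-unique (mirror-times (positions⇒times word n∸k≢0 positions)) k))
    where
    n∸k≢0 : ∀ k → n ∸ toℕ k ≢ 0
    n∸k≢0 k = m<n⇒n≢0 (m<n⇒0<n∸m (Fin.toℕ<n k))

  BothClimb : ℕ → Set
  BothClimb t = Up.Climbs t × Down.Climbs t

  heightSum : ℕ → ℕ
  heightSum t = P t + Q′ t

  heightSum-both : ∀ {t} → t < N → BothClimb t → heightSum t ≡ suc n
  heightSum-both {t} t<N (up , down) = begin
    P t + Q′ t         ≡⟨ cong₂ _+_ (sym up) (sym down) ⟩
    ℓ t + (suc n ∸ ℓ t) ≡⟨ m+[n∸m]≡n (ℓ≤1+n t t<N) ⟩
    suc n              ∎
    where open ≡-Reasoning

  heightSum-both-step : ∀ {t} → BothClimb t → heightSum (suc t) ≡ suc (suc (heightSum t))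
  heightSum-both-step {t} (up , down) =
    trans (cong₂ _+_ (Up.climb-step up) (Down.climb-step down)) (cong suc (+-suc (P t) (Q′ t)))

  heightSum-step : ∀ {t} → t < N → ¬ BothClimb t → heightSum (suc t) ≤ suc (heightSum t)
  heightSum-step {t} t<N not-both with ℓ t ≟ P t
  ... | no  up-rests = begin
    P (suc t) + Q′ (suc t) ≡⟨ cong (_+ Q′ (suc t)) (Up.rest-step t<N up-rests) ⟩
    P t + Q′ (suc t)       ≤⟨ +-monoʳ-≤ (P t) (Down.height-step-≤suc t t<N) ⟩
    P t + suc (Q′ t)       ≡⟨ +-suc (P t) (Q′ t) ⟩
    suc (P t + Q′ t)       ∎
    where open ≤-Reasoning
  ... | yes up-climbs = ≤-reflexive (cong₂ _+_ (Up.climb-step up-climbs)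
                                               (Down.rest-step t<N λ down → not-both (up-climbs , down)))

  P≢Q : ∀ t → t ≤ N → P t ≢ Q t
  P≢Q t t≤N P≡Q = <⇒≢ (s≤s n≥1) (begin
    1              ≡⟨ sym (orbit-prefix 1 t t≤N) ⟩
    prefix t (P t) ≡⟨ cong (prefix t) P≡Q ⟩
    prefix t (Q t) ≡⟨ orbit-prefix (suc n) t t≤N ⟩
    suc n          ∎)
    where open ≡-Reasoning

  heightSum≢2+n : ∀ t → t ≤ N → heightSum t ≢ suc (suc n)
  heightSum≢2+n t t≤N sum≡2+n = P≢Q t t≤N (+-cancelʳ-≡ (suc (suc n) ∸ Q t) (P t) (Q t) (begin
    P t + (suc (suc n) ∸ Q t) ≡⟨ cong (P t +_) (sym (Q′≡reflected-Q t t≤N)) ⟩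
    P t + Q′ t                ≡⟨ sum≡2+n ⟩
    suc (suc n)               ≡⟨ sym (m+[n∸m]≡n (Q≤2+n t t≤N)) ⟩
    Q t + (suc (suc n) ∸ Q t) ∎))
    where open ≡-Reasoning

  -- The sum of the two heights is nondecreasing, runs from 2 to 2n+2 in steps of at most 2 and
  -- never equals n+2, so it passes n+2 exactly once, at a step where both orbits climb.
  crossing : Σ ℕ λ t → t < N × BothClimb t
  crossing with upcrossing heightSum N (s≤s n≥1) (subst (suc n <_) (sym (cong₂ _+_ P-top Q′-top)) (m<m+n (suc n) z<s))
  ... | t , t<N , sum≤1+n , 1+n<sum with (ℓ t ≟ P t) ×-dec (ℓ′ t ≟ Q′ t)
  ...   | yes both    = t , t<N , both
  ...   | no not-both = ⊥-elim (heightSum≢2+n (suc t) t<N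
          (≤-antisym (≤-trans (heightSum-step t<N not-both) (s≤s sum≤1+n)) 1+n<sum))

  no-second-crossing : ∀ {t t′} → t < N → t′ < N → BothClimb t → BothClimb t′ → ¬ t < t′
  no-second-crossing {t} {t′} t<N t′<N both both′ t<t′ = <-irrefl refl (begin-strict
    suc n                   ≡⟨ sym (heightSum-both t<N both) ⟩
    heightSum t             <⟨ m<n⇒m<1+n (n<1+n _) ⟩
    suc (suc (heightSum t)) ≡⟨ sym (heightSum-both-step both) ⟩
    heightSum (suc t)       ≤⟨ +-mono-≤ (Up.height-mono t<t′ (<⇒≤ t′<N)) (Down.height-mono t<t′ (<⇒≤ t′<N)) ⟩
    heightSum t′            ≡⟨ heightSum-both t′<N both′ ⟩
    suc n                   ∎)
    where open ≤-Reasoning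

  crossing-unique : ∀ {t t′} → t < N → t′ < N → BothClimb t → BothClimb t′ → t ≡ t′
  crossing-unique {t} {t′} t<N t′<N both both′ with <-cmp t t′
  ... | tri≈ _ t≡t′ _ = t≡t′
  ... | tri< t<t′ _ _ = ⊥-elim (no-second-crossing t<N t′<N both both′ t<t′)
  ... | tri> _ _ t′<t = ⊥-elim (no-second-crossing t′<N t<N both′ both t′<t)

  crossingTime : ℕ
  crossingTime = proj₁ crossing

  crossingTime-< : crossingTime < N
  crossingTime-< = proj₁ (proj₂ crossing)

  crossingTime-bothClimb : BothClimb crossingTime
  crossingTime-bothClimb = proj₂ (proj₂ crossing)

  crossingIndex : Fin n
  crossingIndex = proj₁ (Up.climb⇒climbTime crossingTime-< (proj₁ crossingTime-bothClimb))

  climbTime-crossingIndex : Up.climbTime crossingIndex ≡ crossingTime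
  climbTime-crossingIndex = proj₂ (Up.climb⇒climbTime crossingTime-< (proj₁ crossingTime-bothClimb))

  a-crossingIndex-shared : Σ (Fin n) λ j → a crossingIndex ≡ d j
  a-crossingIndex-shared = proj₁ descending-at-crossing ,
    cong suc (trans climbTime-crossingIndex (sym (proj₂ descending-at-crossing)))
    where
    descending-at-crossing : Σ (Fin n) λ j → Down.climbTime j ≡ crossingTime
    descending-at-crossing = Down.climb⇒climbTime crossingTime-< (proj₂ crossingTime-bothClimb)

  a-shared⇒crossingIndex : ∀ k j → a k ≡ d j → k ≡ crossingIndex
  a-shared⇒crossingIndex k j ak≡dj = Up.climbTime-injective (trans
    (crossing-unique (Up.climbTime-< k) crossingTime-< (Up.climbTime-climbs k , down-climbs) crossingTime-bothClimb)
    (sym climbTime-crossingIndex))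
    where
    down-climbs : Down.Climbs (Up.climbTime k)
    down-climbs = subst Down.Climbs (sym (suc-injective ak≡dj)) (Down.climbTime-climbs j)

  a-meets-descending : ∀ d′ → IsDescendingPositions d′ → interSize a d′ ≡ 1
  a-meets-descending d′ positions =
    trans (cong (length ∘ filter (_∈? image)) (List.map-tabulate id a))
          (count-tabulate-unique (_∈? image) a crossingIndex crossingIndex-shared only-crossingIndex)
    where
    image : List ℕ
    image = map d′ (allFin n)

    crossingIndex-shared : a crossingIndex ∈ image
    crossingIndex-shared = subst (_∈ image) (trans (d-unique d′ positions j) (sym a≡dj)) (∈-map⁺ d′ (∈-allFin j))
      where
      j : Fin n
      j = proj₁ a-crossingIndex-shared
      a≡dj : a crossingIndex ≡ d j
      a≡dj = proj₂ a-crossingIndex-shared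

    only-crossingIndex : ∀ k → a k ∈ image → k ≡ crossingIndex
    only-crossingIndex k ak∈image =
      a-shared⇒crossingIndex k j (trans (proj₂ (proj₂ (∈-map⁻ d′ ak∈image))) (d-unique d′ positions j))
      where
      j : Fin n
      j = proj₁ (∈-map⁻ d′ ak∈image)

lemma3p2 : (n : ℕ) → 1 ≤ n → (word : List ℕ) → IsReducedWord n (w0 n) word →
    (Σ (Fin n → ℕ) λ d → IsSubseqPositions (nbar n) word (λ k → n ∸ toℕ k) d
    × (∀ d′ → IsSubseqPositions (nbar n) word (λ k → n ∸ toℕ k) d′ → ∀ k → d′ k ≡ d k))
    × (Σ (Fin n → ℕ) λ a → IsSubseqPositions (nbar n) word (λ k → suc (toℕ k)) a
    × (∀ a′ → IsSubseqPositions (nbar n) word (λ k → suc (toℕ k)) a′ → ∀ k → a′ k ≡ a k)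
    × (∀ d → IsSubseqPositions (nbar n) word (λ k → n ∸ toℕ k) d → interSize a d ≡ 1))
lemma3p2 n n≥1 word reduced =
  (d , d-positions , d-unique) , (a , a-positions , a-unique , a-meets-descending)
  where open ReducedWordOfLongest n n≥1 word reduced
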